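{- Let $t\ge 2$ and $\lambda\ge 1$ be integers with $(t,\lambda)\neq(2,1)$, and let $D$ be a $(t,\lambda)$-liking digraph. If there exists a vertex $v$ of $D$ with $N^+(v)=V(D)\setminus\{v\}$, then $D$ is isomorphic to the complete digraph $\overleftrightarrow{K}_{t+\lambda}$ on $t+\lambda$ vertices.
   Context: All digraphs are finite and have no loops and no multiple arcs. A digraph $D$ is a $(t,\lambda)$-liking digraph if every set of $t$ distinct vertices of $D$ has exactly $\lambda$ common out-neighbors (the definition presumes $D$ has at least $t$ vertices). $N^+(v)$ denotes the set of out-neighbors of $v$. $\overleftrightarrow{K}_n$ is the digraph on $n$ vertices with both arcs between every pair of distinct vertices. -}

module Defs where

open import Data.Nat using (ℕ; _≤_)
open import Data.Bool using (Bool; true; false)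
open import Data.Fin using (Fin)
open import Data.Fin.Subset using (Subset; _∈_; ∣_∣)
open import Data.Vec using (tabulate)
open import Data.Product using (Σ; _×_)
open import Relation.Binary.PropositionalEquality using (_≡_; _≢_)
open import Relation.Nullary using (¬_; does)
open import Data.Fin.Properties using (_≟_)
open import Data.Fin.Subset.Properties using (_∈?_)
open import Data.Bool using (_∧_; not)
open import Function.Bundles using (_⤖_; Bijection)

record Digraph : Set where
  field
    n     : ℕ
    adj   : Fin n → Fin n → Bool
    loopless : ∀ v → adj v v ≡ false
open Digraph public

N⁺ : (D : Digraph) → Fin (n D) → Subset (n D)
N⁺ D v = tabulate (λ w → adj D v w)

commonOut : (D : Digraph) → Subset (n D) → Subset (n D)
commonOut D S = tabulate (λ w → allIn w)
  where
    allIn : Fin (n D) → Bool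
    allIn w = Data.Vec.foldr _ _∧_ true
                (tabulate (λ u → not (does (u ∈? S)) Data.Bool.∨ adj D u w))

IsLiking : ℕ → ℕ → Digraph → Set
IsLiking t l D = (t ≤ n D) × (∀ (S : Subset (n D)) → ∣ S ∣ ≡ t → ∣ commonOut D S ∣ ≡ l)

complete : ℕ → Digraph
complete m = record
  { n = m
  ; adj = λ u v → not (does (u ≟ v))
  ; loopless = loop
  }
  where
    open import Relation.Binary.PropositionalEquality using (refl)
    open import Relation.Nullary using (yes; no)
    open import Data.Empty using (⊥-elim)
    loop : ∀ v → not (does (v ≟ v)) ≡ false
    loop v with v ≟ v
    ... | yes _ = refl
    ... | no ¬p = ⊥-elim (¬p refl)

_≅_ : Digraph → Digraph → Set
D ≅ E = Σ (Fin (n D) ⤖ Fin (n E)) λ f →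
          ∀ u v → adj D u v ≡ adj E (Bijection.to f u) (Bijection.to f v)

{-# OPTIONS --safe #-}
module Submission where

-- Write C X for the common out-neighbours of X and let v point to every other vertex.
-- If some u ≠ v did not point to v, take a (t−1)-set S ∋ u avoiding v and x ∈ C (S ∪ {v}):
-- then C (S ∪ {x}) ⊆ C (S ∪ {v}) − x has fewer than λ elements. Hence v ∈ C T for every
-- t-set T ∌ v, and for a (t−1)-set S ∌ v and q ∉ S ∪ {v} we get
-- C (S ∪ {q}) − v = C (S ∪ {v}) ∩ N⁺(q), of size λ − 1: q misses exactly one vertex of
-- C (S ∪ {v}). This rigidity forces every arc between vertices other than v.
-- For λ ≥ 2 a missing arc u ↛ y is refuted by applying this to several sets A ∪ {q}
-- sharing a (t−2)-set A. For λ = 1 (so t ≥ 3) take a (t−2)-set B ∋ u avoiding v and y: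
-- sending x ∉ B ∪ {v} to the unique vertex of C (B ∪ {x, v}) is injective and misses y,
-- contradicting the pigeonhole principle. Finally a complete digraph has n − t common
-- out-neighbours for each t-set, so n = t + λ.

open import Defs
import Data.Nat as ℕ
open import Data.Nat using (ℕ; zero; suc; _+_; _∸_; _≤_; _<_; z≤n; s≤s)
open import Data.Nat.Properties
  using (module ≤-Reasoning; ≤-<-trans; <⇒≱; 1+n≰n; n≮0; n<1+n; n≢0⇒n>0; +-suc; +-comm; suc-injective; m+n≤o⇒m≤o∸n; m+[n∸m]≡n)
open import Data.Bool using (Bool; true; false; not; _∧_; _∨_)
open import Data.Bool.Properties using (∧-conicalˡ; ∧-conicalʳ) renaming (_≟_ to _≟ᵇ_)
open import Data.Empty using (⊥)
open import Data.Fin using (Fin; zero; suc)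
open import Data.Fin.Properties using (_≟_)
open import Data.Fin.Subset hiding (⊥)
open import Data.Fin.Subset using () renaming (⊥ to ∅)
open import Data.Fin.Subset.Properties
open import Data.Vec using (_∷_; here; there; tabulate; foldr)
open import Data.Vec.Properties using ([]=⇒lookup; lookup⇒[]=; lookup∘tabulate)
open import Data.Product using (∃; _×_; _,_; proj₁; proj₂)
import Data.Product as Product
open import Data.Sum using (_⊎_; inj₁; inj₂)
import Data.Sum as Sum
open import Function using (_∘_)
open import Function.Construct.Identity using (⤖-id)
open import Relation.Binary.PropositionalEquality
open import Relation.Nullary using (¬_; yes; no; does; contradiction)
open import Relation.Nullary.Decidable using (decidable-stable)

private variable
  m r : ℕ
  p q F : Subset m
  x y : Fin m

infixl 5 _∪⁅_⁆
_∪⁅_⁆ : Subset m → Fin m → Subset m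
p ∪⁅ x ⁆ = p ∪ ⁅ x ⁆

x∈p∪⁅x⁆ : x ∈ p ∪⁅ x ⁆
x∈p∪⁅x⁆ {x = x} {p = p} = q⊆p∪q p ⁅ x ⁆ (x∈⁅x⁆ x)

p⊆p∪⁅x⁆ : p ⊆ p ∪⁅ x ⁆
p⊆p∪⁅x⁆ {x = x} = p⊆p∪q ⁅ x ⁆

x∈p∪⁅y⁆⁻ : x ∈ p ∪⁅ y ⁆ → x ∈ p ⊎ x ≡ y
x∈p∪⁅y⁆⁻ {p = p} {y = y} x∈ = Sum.map₂ (x∈⁅y⁆⇒x≡y y) (x∈p∪q⁻ p ⁅ y ⁆ x∈)

Lift-∪⁅⁆ : {P : Fin m → Set} → Lift P p → P x → Lift P (p ∪⁅ x ⁆)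
Lift-∪⁅⁆ all Px z∈ with x∈p∪⁅y⁆⁻ z∈
... | inj₁ z∈p  = all z∈p
... | inj₂ refl = Px

x∉p∪⁅y⁆ : x ∉ p → x ≢ y → x ∉ p ∪⁅ y ⁆
x∉p∪⁅y⁆ x∉p x≢y x∈ with x∈p∪⁅y⁆⁻ x∈
... | inj₁ x∈p = x∉p x∈p
... | inj₂ x≡y = x≢y x≡y

x∈p─q⇒x∉q : x ∈ p ─ q → x ∉ q
x∈p─q⇒x∉q {x = zero}  {p = true ∷ _}  {q = true ∷ _} () here
x∈p─q⇒x∉q {x = zero}  {p = false ∷ _} {q = true ∷ _} () here
x∈p─q⇒x∉q {x = suc x} {p = _ ∷ _}     {q = _ ∷ _} (there x∈) (there x∈q) = x∈p─q⇒x∉q x∈ x∈q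

x∈p-y⇒x≢y : x ∈ p - y → x ≢ y
x∈p-y⇒x≢y {y = y} x∈ refl = x∈p─q⇒x∉q x∈ (x∈⁅x⁆ y)

x∉p∪⁅y⁆⁻ : x ∉ p ∪⁅ y ⁆ → x ∉ p × x ≢ y
x∉p∪⁅y⁆⁻ x∉ = x∉ ∘ p⊆p∪⁅x⁆ , λ { refl → x∉ x∈p∪⁅x⁆ }

p⊆∁q∧x∈q⇒x∉p : p ⊆ ∁ q → x ∈ q → x ∉ p
p⊆∁q∧x∈q⇒x∉p p⊆∁q x∈q x∈p = x∈∁p⇒x∉p (p⊆∁q x∈p) x∈q

∣p∪⁅x⁆∣ : x ∉ p → ∣ p ∪⁅ x ⁆ ∣ ≡ suc ∣ p ∣
∣p∪⁅x⁆∣ {x = zero}  {p = true ∷ p}  x∉p = contradiction here x∉p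
∣p∪⁅x⁆∣ {x = zero}  {p = false ∷ p} x∉p = cong (suc ∘ ∣_∣) (∪-identityʳ p)
∣p∪⁅x⁆∣ {x = suc x} {p = true ∷ p}  x∉p = cong suc (∣p∪⁅x⁆∣ (drop-not-there x∉p))
∣p∪⁅x⁆∣ {x = suc x} {p = false ∷ p} x∉p = ∣p∪⁅x⁆∣ (drop-not-there x∉p)

∣p∣≡1+∣p-x∣ : x ∈ p → ∣ p ∣ ≡ suc ∣ p - x ∣
∣p∣≡1+∣p-x∣ {x = zero}  {p = true ∷ p}  here       = cong suc (sym (cong ∣_∣ (p─⊥≡p p)))
∣p∣≡1+∣p-x∣ {x = suc x} {p = true ∷ p}  (there x∈) = cong suc (∣p∣≡1+∣p-x∣ x∈)
∣p∣≡1+∣p-x∣ {x = suc x} {p = false ∷ p} (there x∈) = ∣p∣≡1+∣p-x∣ x∈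

∣p∣≡0⇒x∉p : ∣ p ∣ ≡ 0 → x ∉ p
∣p∣≡0⇒x∉p {p = p} {x = x} ∣p∣≡0 x∈p = n≮0 (subst (∣ p - x ∣ <_) ∣p∣≡0 (x∈p⇒∣p-x∣<∣p∣ x∈p))

nonempty : ∀ {m} (p : Subset m) → 0 < ∣ p ∣ → Nonempty p
nonempty (true ∷ p)  _  = zero , here
nonempty (false ∷ p) 0< = Product.map suc there (nonempty p 0<)

∣q∣<∣p∣⇒∃∈p∉q : ∣ q ∣ < ∣ p ∣ → ∃ λ x → x ∈ p × x ∉ q
∣q∣<∣p∣⇒∃∈p∉q {q = true ∷ q}  {p = true ∷ p}  (s≤s lt) =
  Product.map suc (Product.map there (_∘ drop-there)) (∣q∣<∣p∣⇒∃∈p∉q lt)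
∣q∣<∣p∣⇒∃∈p∉q {q = false ∷ q} {p = true ∷ p}  _  = zero , here , λ ()
∣q∣<∣p∣⇒∃∈p∉q {q = b ∷ q}     {p = false ∷ p} lt =
  Product.map suc (Product.map there (_∘ drop-there)) (∣q∣<∣p∣⇒∃∈p∉q (≤-<-trans (∣p∣≤∣x∷p∣ b q) lt))

subsetOfSize : ∀ {m r} {q : Subset m} → r ≤ ∣ q ∣ → ∃ λ p → p ⊆ q × ∣ p ∣ ≡ r
subsetOfSize {m} {zero} _ = ∅ , ⊥⊆ , ∣⊥∣≡0 m
subsetOfSize {r = suc r} {q = true ∷ q} (s≤s r≤) with subsetOfSize r≤
... | p , p⊆q , ∣p∣≡r = true ∷ p , s⊆s p⊆q , cong suc ∣p∣≡r
subsetOfSize {r = suc r} {q = false ∷ q} r≤ with subsetOfSize r≤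
... | p , p⊆q , ∣p∣≡r = false ∷ p , out⊆ p⊆q , ∣p∣≡r

subsetAvoiding : ∀ {m r} {F : Subset m} → ∣ F ∣ + r ≤ m → ∃ λ A → A ⊆ ∁ F × ∣ A ∣ ≡ r
subsetAvoiding {m} {r} {F} le =
  subsetOfSize (subst (r ≤_) (sym (∣∁p∣≡n∸∣p∣ F)) (m+n≤o⇒m≤o∸n r (subst (_≤ m) (+-comm ∣ F ∣ r) le)))

subsetContainingAvoiding : ∀ {m r} {F : Subset m} {x} → x ∉ F → 0 < r → ∣ F ∣ + r ≤ m → ∃ λ A → A ⊆ ∁ F × x ∈ A × ∣ A ∣ ≡ r
subsetContainingAvoiding {m} {suc r} {F} {x} x∉F _ le
  with subsetAvoiding {r = r} {F = F ∪⁅ x ⁆} (subst (_≤ m) (sym size) le)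
  where size : ∣ F ∪⁅ x ⁆ ∣ + r ≡ ∣ F ∣ + suc r
        size = trans (cong (_+ r) (∣p∪⁅x⁆∣ x∉F)) (sym (+-suc ∣ F ∣ r))
... | A , A⊆∁F∪x , ∣A∣≡r =
  A ∪⁅ x ⁆ , Lift-∪⁅⁆ (λ a∈A → x∉p⇒x∈∁p (x∈∁p⇒x∉p (A⊆∁F∪x a∈A) ∘ p⊆p∪⁅x⁆)) (x∉p⇒x∈∁p x∉F)
           , x∈p∪⁅x⁆ , trans (∣p∪⁅x⁆∣ x∉A) (cong suc ∣A∣≡r)
  where x∉A : x ∉ A
        x∉A x∈A = x∈∁p⇒x∉p (A⊆∁F∪x x∈A) x∈p∪⁅x⁆

injection⇒≤ : ∀ {m k} {p q : Subset m} (R : Fin m → Fin m → Set) → ∣ p ∣ ≡ k →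
              (∀ {x} → x ∈ p → ∃ λ y → y ∈ q × R x y) →
              (∀ {x x′ y} → x ∈ p → x′ ∈ p → R x y → R x′ y → x ≡ x′) → k ≤ ∣ q ∣
injection⇒≤ {k = zero} R _ _ _ = z≤n
injection⇒≤ {k = suc k} {p} {q} R ∣p∣≡1+k image injective with nonempty p (subst (0 <_) (sym ∣p∣≡1+k) (s≤s z≤n))
... | x , x∈p with image x∈p
... | y , y∈q , Rxy = subst (suc k ≤_) (sym (∣p∣≡1+∣p-x∣ y∈q)) (s≤s (injection⇒≤ R ∣p-x∣≡k image′ injective′))
  where
  x′∈p : ∀ {x′} → x′ ∈ p - x → x′ ∈ p
  x′∈p = p─q⊆p p ⁅ x ⁆
  ∣p-x∣≡k : ∣ p - x ∣ ≡ k
  ∣p-x∣≡k = suc-injective (trans (sym (∣p∣≡1+∣p-x∣ x∈p)) ∣p∣≡1+k)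
  image′ : ∀ {x′} → x′ ∈ p - x → ∃ λ y′ → y′ ∈ q - y × R x′ y′
  image′ x′∈ with image (x′∈p x′∈)
  ... | y′ , y′∈q , Rx′y′ = y′ , x∈p∧x≢y⇒x∈p-y y′∈q y′≢y , Rx′y′
    where y′≢y : y′ ≢ y
          y′≢y refl = x∈p-y⇒x≢y x′∈ (injective (x′∈p x′∈) x∈p Rx′y′ Rxy)
  injective′ : ∀ {x₁ x₂ y′} → x₁ ∈ p - x → x₂ ∈ p - x → R x₁ y′ → R x₂ y′ → x₁ ≡ x₂
  injective′ x₁∈ x₂∈ = injective (x′∈p x₁∈) (x′∈p x₂∈)

∈tabulate⁻ : ∀ {m} (f : Fin m → Bool) {x} → x ∈ tabulate f → f x ≡ true
∈tabulate⁻ f {x} x∈ = trans (sym (lookup∘tabulate f x)) ([]=⇒lookup x∈)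

∈tabulate⁺ : ∀ {m} (f : Fin m → Bool) {x} → f x ≡ true → x ∈ tabulate f
∈tabulate⁺ f {x} fx = lookup⇒[]= x (tabulate f) (trans (lookup∘tabulate f x) fx)

and-tabulate⁻ : ∀ {m} (g : Fin m → Bool) → foldr _ _∧_ true (tabulate g) ≡ true → ∀ i → g i ≡ true
and-tabulate⁻ g all zero    = ∧-conicalˡ _ _ all
and-tabulate⁻ g all (suc i) = and-tabulate⁻ (g ∘ suc) (∧-conicalʳ _ _ all) i

and-tabulate⁺ : ∀ {m} (g : Fin m → Bool) → (∀ i → g i ≡ true) → foldr _ _∧_ true (tabulate g) ≡ true
and-tabulate⁺ {zero}  g _   = refl
and-tabulate⁺ {suc m} g all = cong₂ _∧_ (all zero) (and-tabulate⁺ (g ∘ suc) (all ∘ suc))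

module Arcs (D : Digraph) where

  V : Set
  V = Fin (n D)

  infix 4 _⟶_ _⇉_

  _⟶_ : V → V → Set
  u ⟶ w = adj D u w ≡ true

  _⇉_ : Subset (n D) → V → Set
  X ⇉ c = Lift (_⟶ c) X

  ⟶-stable : ∀ {u w} → ¬ ¬ (u ⟶ w) → u ⟶ w
  ⟶-stable {u} {w} = decidable-stable (adj D u w ≟ᵇ true)

  ⟶-irrefl : ∀ {u} → ¬ u ⟶ u
  ⟶-irrefl {u} u⟶u with trans (sym u⟶u) (loopless D u)
  ... | ()

  ⟶-≢ : ∀ {u a b} → u ⟶ a → ¬ u ⟶ b → a ≢ b
  ⟶-≢ u⟶a u↛b refl = u↛b u⟶a

  ∈N⁺⁻ : ∀ {u w} → w ∈ N⁺ D u → u ⟶ w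
  ∈N⁺⁻ {u} = ∈tabulate⁻ (adj D u)

  ∈commonOut⁻ : ∀ {X c} → c ∈ commonOut D X → X ⇉ c
  ∈commonOut⁻ {X} c∈ {u} u∈X with and-tabulate⁻ _ (∈tabulate⁻ _ c∈) u
  ... | holds with u ∈? X
  ...   | yes _   = holds
  ...   | no u∉X = contradiction u∈X u∉X

  ∈commonOut⁺ : ∀ {X c} → X ⇉ c → c ∈ commonOut D X
  ∈commonOut⁺ {X} {c} X⇉c = ∈tabulate⁺ _ (and-tabulate⁺ _ holds)
    where
    holds : ∀ u → not (does (u ∈? X)) ∨ adj D u c ≡ true
    holds u with u ∈? X
    ... | yes u∈X = X⇉c u∈X
    ... | no _    = refl

  ∈commonOut⇒∉ : ∀ {X c} → c ∈ commonOut D X → c ∉ X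
  ∈commonOut⇒∉ c∈ c∈X = ⟶-irrefl (∈commonOut⁻ c∈ c∈X)

  liking⇒t<n : ∀ {t l} → IsLiking t (suc l) D → t < n D
  liking⇒t<n {t} (t≤n , liking) with subsetOfSize {q = ⊤} (subst (t ≤_) (sym (∣⊤∣≡n (n D))) t≤n)
  ... | T , _ , ∣T∣≡t with nonempty (commonOut D T) (subst (0 <_) (sym (liking T ∣T∣≡t)) (s≤s z≤n))
  ... | c , c∈C = begin-strict
    t             ≡⟨ ∣T∣≡t ⟨
    ∣ T ∣         ≤⟨ p⊆q⇒∣p∣≤∣q∣ T⊆⊤-c ⟩
    ∣ ⊤ - c ∣     <⟨ x∈p⇒∣p-x∣<∣p∣ (∈⊤ {x = c}) ⟩
    ∣ ⊤ {n D} ∣   ≡⟨ ∣⊤∣≡n (n D) ⟩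
    n D           ∎
    where
    open ≤-Reasoning
    T⊆⊤-c : T ⊆ ⊤ - c
    T⊆⊤-c {u} u∈T = x∈p∧x≢y⇒x∈p-y ∈⊤ λ { refl → ∈commonOut⇒∉ c∈C u∈T }

  module _ (⟶all : ∀ {u w} → u ≢ w → u ⟶ w) where

    ≅complete : D ≅ complete (n D)
    ≅complete = ⤖-id _ , arc
      where
      arc : ∀ u w → adj D u w ≡ not (does (u ≟ w))
      arc u w with u ≟ w
      ... | yes refl = loopless D u
      ... | no u≢w   = ⟶all u≢w

    liking⇒n≡t+l : ∀ {t l} → IsLiking t l D → n D ≡ t + l
    liking⇒n≡t+l {t} {l} (t≤n , liking) with subsetOfSize {q = ⊤} (subst (t ≤_) (sym (∣⊤∣≡n (n D))) t≤n)
    ... | T , _ , ∣T∣≡t = begin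
      n D             ≡⟨ m+[n∸m]≡n t≤n ⟨
      t + (n D ∸ t)   ≡⟨ cong (λ s → t + (n D ∸ s)) ∣T∣≡t ⟨
      t + (n D ∸ ∣ T ∣) ≡⟨ cong (t +_) (∣∁p∣≡n∸∣p∣ T) ⟨
      t + ∣ ∁ T ∣     ≡⟨ cong (λ X → t + ∣ X ∣) commonOut≡∁ ⟨
      t + ∣ commonOut D T ∣ ≡⟨ cong (t +_) (liking T ∣T∣≡t) ⟩
      t + l           ∎
      where
      open ≡-Reasoning
      commonOut≡∁ : commonOut D T ≡ ∁ T
      commonOut≡∁ = ⊆-antisym (x∉p⇒x∈∁p ∘ ∈commonOut⇒∉)
                              (λ c∈∁T → ∈commonOut⁺ λ u∈T → ⟶all λ { refl → x∈∁p⇒x∉p c∈∁T u∈T })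

  -- t = 2 + r and λ = 1 + k; a Base is a (t−1)-set avoiding v.
  module Dominating {r k : ℕ} (t≤n : 2 + r ≤ n D)
                    (liking : ∀ T → ∣ T ∣ ≡ 2 + r → ∣ commonOut D T ∣ ≡ suc k)
                    (v : V) (v⟶ : ∀ {w} → w ≢ v → v ⟶ w) where

    C : Subset (n D) → Subset (n D)
    C = commonOut D

    Cᵥ : Subset (n D) → Subset (n D)
    Cᵥ S = C (S ∪⁅ v ⁆)

    Base : Subset (n D) → Set
    Base S = v ∉ S × ∣ S ∣ ≡ suc r

    base-∪⁅⁆ : ∀ {S x} → v ∉ S → ∣ S ∣ ≡ r → x ∉ S → x ≢ v → Base (S ∪⁅ x ⁆)
    base-∪⁅⁆ v∉S ∣S∣≡r x∉S x≢v = x∉p∪⁅y⁆ v∉S (≢-sym x≢v) , trans (∣p∪⁅x⁆∣ x∉S) (cong suc ∣S∣≡r)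

    ∣Cᵥ∣ : ∀ {S} → Base S → ∣ Cᵥ S ∣ ≡ suc k
    ∣Cᵥ∣ {S} (v∉S , ∣S∣≡1+r) = liking (S ∪⁅ v ⁆) (trans (∣p∪⁅x⁆∣ v∉S) (cong suc ∣S∣≡1+r))

    ∈Cᵥ⇒≢v : ∀ {S c} → c ∈ Cᵥ S → c ≢ v
    ∈Cᵥ⇒≢v c∈C refl = ∈commonOut⇒∉ c∈C x∈p∪⁅x⁆

    ∈Cᵥ⇒∉ : ∀ {S c} → c ∈ Cᵥ S → c ∉ S
    ∈Cᵥ⇒∉ c∈C = ∈commonOut⇒∉ c∈C ∘ p⊆p∪⁅x⁆

    base⇒⟶v : ∀ {S u} → Base S → u ∈ S → u ⟶ v
    base⇒⟶v {S} {u} base@(v∉S , ∣S∣≡1+r) u∈S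
      with nonempty (Cᵥ S) (subst (0 <_) (sym (∣Cᵥ∣ base)) (s≤s z≤n))
    ... | x , x∈M = ⟶-stable λ u↛v → <⇒≱ (x∈p⇒∣p-x∣<∣p∣ x∈M) (begin
        ∣ Cᵥ S ∣          ≡⟨ ∣Cᵥ∣ base ⟩
        suc k            ≡⟨ liking _ (trans (∣p∪⁅x⁆∣ (∈Cᵥ⇒∉ x∈M)) (cong suc ∣S∣≡1+r)) ⟨
        ∣ C (S ∪⁅ x ⁆) ∣  ≤⟨ p⊆q⇒∣p∣≤∣q∣ (C[S∪⁅x⁆]⊆M-x u↛v) ⟩
        ∣ Cᵥ S - x ∣      ∎)
      where
      open ≤-Reasoning
      C[S∪⁅x⁆]⊆M-x : ¬ u ⟶ v → C (S ∪⁅ x ⁆) ⊆ Cᵥ S - x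
      C[S∪⁅x⁆]⊆M-x u↛v {c} c∈ = x∈p∧x≢y⇒x∈p-y
          (∈commonOut⁺ (Lift-∪⁅⁆ (S∪x⇉c ∘ p⊆p∪⁅x⁆) (v⟶ (⟶-≢ (S∪x⇉c (p⊆p∪⁅x⁆ u∈S)) u↛v))))
          (⟶-≢ (S∪x⇉c x∈p∪⁅x⁆) ⟶-irrefl)
        where S∪x⇉c = ∈commonOut⁻ c∈

    ⟶v : ∀ {u} → u ≢ v → u ⟶ v
    ⟶v u≢v with subsetContainingAvoiding (x≢y⇒x∉⁅y⁆ u≢v) (s≤s z≤n)
                  (subst (λ j → j + suc r ≤ n D) (sym (∣⁅x⁆∣≡1 v)) t≤n)
    ... | S , S⊆∁⁅v⁆ , u∈S , ∣S∣≡1+r =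
      base⇒⟶v (p⊆∁q∧x∈q⇒x∉p S⊆∁⁅v⁆ (x∈⁅x⁆ v) , ∣S∣≡1+r) u∈S

    v∈C : ∀ {T} → v ∉ T → v ∈ C T
    v∈C v∉T = ∈commonOut⁺ λ u∈T → ⟶v λ { refl → v∉T u∈T }

    ∣C-v∣ : ∀ {T} → ∣ T ∣ ≡ 2 + r → v ∉ T → ∣ C T - v ∣ ≡ k
    ∣C-v∣ ∣T∣≡2+r v∉T = suc-injective (trans (sym (∣p∣≡1+∣p-x∣ (v∈C v∉T))) (liking _ ∣T∣≡2+r))

    ∣C[S∪⁅q⁆]-v∣ : ∀ {S q} → Base S → q ∉ S → q ≢ v → ∣ C (S ∪⁅ q ⁆) - v ∣ ≡ k
    ∣C[S∪⁅q⁆]-v∣ (v∉S , ∣S∣≡1+r) q∉S q≢v =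
      ∣C-v∣ (trans (∣p∪⁅x⁆∣ q∉S) (cong suc ∣S∣≡1+r)) (x∉p∪⁅y⁆ v∉S (≢-sym q≢v))

    ∈C[S∪⁅q⁆]-v⁺ : ∀ {S q c} → c ∈ Cᵥ S → q ⟶ c → c ∈ C (S ∪⁅ q ⁆) - v
    ∈C[S∪⁅q⁆]-v⁺ c∈C q⟶c =
      x∈p∧x≢y⇒x∈p-y (∈commonOut⁺ (Lift-∪⁅⁆ (∈commonOut⁻ c∈C ∘ p⊆p∪⁅x⁆) q⟶c)) (∈Cᵥ⇒≢v c∈C)

    ∈C[S∪⁅q⁆]-v⁻ : ∀ {S q c} → c ∈ C (S ∪⁅ q ⁆) - v → c ∈ Cᵥ S × q ⟶ c
    ∈C[S∪⁅q⁆]-v⁻ {S} {q} c∈ =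
      ∈commonOut⁺ (Lift-∪⁅⁆ (S∪q⇉c ∘ p⊆p∪⁅x⁆) (v⟶ (x∈p-y⇒x≢y c∈))) , S∪q⇉c x∈p∪⁅x⁆
      where S∪q⇉c = ∈commonOut⁻ (p─q⊆p _ _ c∈)

    missesSome : ∀ {S q} → Base S → q ∉ S → q ≢ v → ∃ λ z → z ∈ Cᵥ S × ¬ q ⟶ z
    missesSome base q∉S q≢v
      with ∣q∣<∣p∣⇒∃∈p∉q (subst₂ _<_ (sym (∣C[S∪⁅q⁆]-v∣ base q∉S q≢v)) (sym (∣Cᵥ∣ base)) (n<1+n k))
    ... | z , z∈C , z∉C[S∪q]-v = z , z∈C , z∉C[S∪q]-v ∘ ∈C[S∪⁅q⁆]-v⁺ z∈C

    missesAtMostOne : ∀ {S q z₁ z₂} → Base S → q ∉ S → q ≢ v →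
                      z₁ ∈ Cᵥ S → z₂ ∈ Cᵥ S → z₁ ≢ z₂ → ¬ q ⟶ z₁ → q ⟶ z₂
    missesAtMostOne {S} {q} {z₁} {z₂} base q∉S q≢v z₁∈C z₂∈C z₁≢z₂ q↛z₁ =
      ⟶-stable λ q↛z₂ → <⇒≱ ∣M-z₁-z₂∣<k
        (subst (_≤ _) (∣C[S∪⁅q⁆]-v∣ base q∉S q≢v) (p⊆q⇒∣p∣≤∣q∣ (C[S∪⁅q⁆]-v⊆M-z₁-z₂ q↛z₂)))
      where
      M : Subset (n D)
      M = Cᵥ S
      ∣M-z₁∣≡k : ∣ M - z₁ ∣ ≡ k
      ∣M-z₁∣≡k = suc-injective (trans (sym (∣p∣≡1+∣p-x∣ z₁∈C)) (∣Cᵥ∣ base))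
      ∣M-z₁-z₂∣<k : ∣ M - z₁ - z₂ ∣ < k
      ∣M-z₁-z₂∣<k = subst (_ <_) ∣M-z₁∣≡k (x∈p⇒∣p-x∣<∣p∣ (x∈p∧x≢y⇒x∈p-y z₂∈C (≢-sym z₁≢z₂)))
      C[S∪⁅q⁆]-v⊆M-z₁-z₂ : ¬ q ⟶ z₂ → C (S ∪⁅ q ⁆) - v ⊆ M - z₁ - z₂
      C[S∪⁅q⁆]-v⊆M-z₁-z₂ q↛z₂ c∈ with ∈C[S∪⁅q⁆]-v⁻ c∈
      ... | c∈M , q⟶c = x∈p∧x≢y⇒x∈p-y (x∈p∧x≢y⇒x∈p-y c∈M (⟶-≢ q⟶c q↛z₁)) (⟶-≢ q⟶c q↛z₂)

    ⟶-within : ∀ {S z z′} → Base S → z ∈ Cᵥ S → z′ ∈ Cᵥ S → z ≢ z′ → z ⟶ z′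
    ⟶-within base z∈C z′∈C z≢z′ =
      missesAtMostOne base (∈Cᵥ⇒∉ z∈C) (∈Cᵥ⇒≢v z∈C) z∈C z′∈C z≢z′ ⟶-irrefl

    ∈Cᵥ-swap : ∀ {A q q′ c} → c ∈ Cᵥ (A ∪⁅ q ⁆) → q′ ⟶ c → c ∈ Cᵥ (A ∪⁅ q′ ⁆)
    ∈Cᵥ-swap c∈C q′⟶c =
      ∈commonOut⁺ (Lift-∪⁅⁆ (Lift-∪⁅⁆ (∈commonOut⁻ c∈C ∘ p⊆p∪⁅x⁆ ∘ p⊆p∪⁅x⁆) q′⟶c) (v⟶ (∈Cᵥ⇒≢v c∈C)))

    -- y misses some a ∈ M, and Cᵥ (A ∪ {y}) is M − a plus one vertex e. Then b → e and a → e
    -- for b ∈ M − a, so A ∪ {a, y} has λ common out-neighbours besides v.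
    module AtLeastTwoCommonOut (0<k : 0 < k) {u y A} (u≢v : u ≢ v) (y≢v : y ≢ v) (u≢y : u ≢ y)
                               (u↛y : ¬ u ⟶ y) (v∉A : v ∉ A) (u∉A : u ∉ A) (y∉A : y ∉ A)
                               (∣A∣≡r : ∣ A ∣ ≡ r) where

      base : ∀ {q} → q ∉ A → q ≢ v → Base (A ∪⁅ q ⁆)
      base = base-∪⁅⁆ v∉A ∣A∣≡r

      M : Subset (n D)
      M = Cᵥ (A ∪⁅ u ⁆)

      baseᵤ : Base (A ∪⁅ u ⁆)
      baseᵤ = base u∉A u≢v

      ∈M⇒∉A : ∀ {z} → z ∈ M → z ∉ A
      ∈M⇒∉A z∈M = ∈Cᵥ⇒∉ z∈M ∘ p⊆p∪⁅x⁆

      base-∈M : ∀ {z} → z ∈ M → Base (A ∪⁅ z ⁆)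
      base-∈M z∈M = base (∈M⇒∉A z∈M) (∈Cᵥ⇒≢v z∈M)

      y∉A∪⁅u⁆ : y ∉ A ∪⁅ u ⁆
      y∉A∪⁅u⁆ = x∉p∪⁅y⁆ y∉A (≢-sym u≢y)

      ∈M⇒≢y : ∀ {z} → z ∈ M → z ≢ y
      ∈M⇒≢y z∈M refl = u↛y (∈commonOut⁻ z∈M (p⊆p∪⁅x⁆ x∈p∪⁅x⁆))

      a,a∈M,y↛a : ∃ λ a → a ∈ M × ¬ y ⟶ a
      a,a∈M,y↛a = missesSome baseᵤ y∉A∪⁅u⁆ y≢v

      a : V
      a = proj₁ a,a∈M,y↛a

      a∈M : a ∈ M
      a∈M = proj₁ (proj₂ a,a∈M,y↛a)

      y↛a : ¬ y ⟶ a
      y↛a = proj₂ (proj₂ a,a∈M,y↛a)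

      y⟶M-a : ∀ {z} → z ∈ M → z ≢ a → y ⟶ z
      y⟶M-a z∈M z≢a = missesAtMostOne baseᵤ y∉A∪⁅u⁆ y≢v a∈M z∈M (≢-sym z≢a) y↛a

      ∣M-a∣≡k : ∣ M - a ∣ ≡ k
      ∣M-a∣≡k = suc-injective (trans (sym (∣p∣≡1+∣p-x∣ a∈M)) (∣Cᵥ∣ baseᵤ))

      b,b∈M-a : Nonempty (M - a)
      b,b∈M-a = nonempty (M - a) (subst (0 <_) (sym ∣M-a∣≡k) 0<k)

      b : V
      b = proj₁ b,b∈M-a

      b∈M : b ∈ M
      b∈M = p─q⊆p M ⁅ a ⁆ (proj₂ b,b∈M-a)

      b≢a : b ≢ a
      b≢a = x∈p-y⇒x≢y (proj₂ b,b∈M-a)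

      P : Subset (n D)
      P = Cᵥ (A ∪⁅ y ⁆)

      M-a⊆P : M - a ⊆ P
      M-a⊆P z∈M-a = ∈Cᵥ-swap z∈M (y⟶M-a z∈M (x∈p-y⇒x≢y z∈M-a))
        where z∈M = p─q⊆p M ⁅ a ⁆ z∈M-a

      e,e∈P,e∉M-a : ∃ λ e → e ∈ P × e ∉ M - a
      e,e∈P,e∉M-a = ∣q∣<∣p∣⇒∃∈p∉q
        (subst₂ _<_ (sym ∣M-a∣≡k) (sym (∣Cᵥ∣ (base y∉A y≢v))) (n<1+n k))

      e : V
      e = proj₁ e,e∈P,e∉M-a

      e∈P : e ∈ P
      e∈P = proj₁ (proj₂ e,e∈P,e∉M-a)

      y⟶e : y ⟶ e
      y⟶e = ∈commonOut⁻ e∈P (p⊆p∪⁅x⁆ x∈p∪⁅x⁆)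

      e∉M : e ∉ M
      e∉M e∈M = proj₂ (proj₂ e,e∈P,e∉M-a) (x∈p∧x≢y⇒x∈p-y e∈M (⟶-≢ y⟶e y↛a))

      b⟶e : b ⟶ e
      b⟶e = missesAtMostOne (base y∉A y≢v) (x∉p∪⁅y⁆ (∈M⇒∉A b∈M) (∈M⇒≢y b∈M))
              (∈Cᵥ⇒≢v b∈M) (M-a⊆P (x∈p∧x≢y⇒x∈p-y b∈M b≢a)) e∈P
              (λ b≡e → e∉M (subst (_∈ M) b≡e b∈M)) ⟶-irrefl

      a⟶e : a ⟶ e
      a⟶e = missesAtMostOne (base-∈M b∈M) (x∉p∪⁅y⁆ (∈M⇒∉A a∈M) (≢-sym b≢a)) (∈Cᵥ⇒≢v a∈M)
              (∈Cᵥ-swap a∈M (⟶-within baseᵤ b∈M a∈M b≢a))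
              (∈Cᵥ-swap e∈P b⟶e)
              (λ a≡e → e∉M (subst (_∈ M) a≡e a∈M)) ⟶-irrefl

      absurd : ⊥
      absurd = 1+n≰n (begin
        suc k                       ≡⟨ cong suc ∣M-a∣≡k ⟨
        suc ∣ M - a ∣               ≡⟨ ∣p∪⁅x⁆∣ (e∉M ∘ p─q⊆p M ⁅ a ⁆) ⟨
        ∣ M - a ∪⁅ e ⁆ ∣            ≤⟨ p⊆q⇒∣p∣≤∣q∣ M-a∪⁅e⁆⊆C[T]-v ⟩
        ∣ C (A ∪⁅ a ⁆ ∪⁅ y ⁆) - v ∣ ≡⟨ ∣C[S∪⁅q⁆]-v∣ (base-∈M a∈M) (x∉p∪⁅y⁆ y∉A (∈M⇒≢y a∈M ∘ sym)) y≢v ⟩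
        k                           ∎)
        where
        open ≤-Reasoning
        M-a∪⁅e⁆⊆C[T]-v : M - a ∪⁅ e ⁆ ⊆ C (A ∪⁅ a ⁆ ∪⁅ y ⁆) - v
        M-a∪⁅e⁆⊆C[T]-v = Lift-∪⁅⁆ {P = _∈ C (A ∪⁅ a ⁆ ∪⁅ y ⁆) - v}
          (λ z∈M-a → let z∈M = p─q⊆p M ⁅ a ⁆ z∈M-a ; z≢a = x∈p-y⇒x≢y z∈M-a in
            ∈C[S∪⁅q⁆]-v⁺ (∈Cᵥ-swap z∈M (⟶-within baseᵤ a∈M z∈M (≢-sym z≢a)))
                         (y⟶M-a z∈M z≢a))
          (∈C[S∪⁅q⁆]-v⁺ (∈Cᵥ-swap e∈P a⟶e) y⟶e)

    module OneCommonOut (k≡0 : k ≡ 0) {u w B} (w≢v : w ≢ v) (u↛w : ¬ u ⟶ w)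
                        (v∉B : v ∉ B) (w∉B : w ∉ B) (u∈B : u ∈ B) (∣B∣≡r : ∣ B ∣ ≡ r) where

      X : Subset (n D)
      X = ∁ (B ∪⁅ v ⁆)

      base : ∀ {x} → x ∈ X → Base (B ∪⁅ x ⁆)
      base x∈X = let x∉B , x≢v = x∉p∪⁅y⁆⁻ (x∈∁p⇒x∉p x∈X) in base-∪⁅⁆ v∉B ∣B∣≡r x∉B x≢v

      R : V → V → Set
      R x c = c ∈ Cᵥ (B ∪⁅ x ⁆)

      image : ∀ {x} → x ∈ X → ∃ λ c → c ∈ X - w × R x c
      image x∈X with nonempty _ (subst (0 <_) (sym (∣Cᵥ∣ (base x∈X))) (s≤s z≤n))
      ... | c , c∈C = c , x∈p∧x≢y⇒x∈p-y c∈X (⟶-≢ (∈commonOut⁻ c∈C (p⊆p∪⁅x⁆ (p⊆p∪⁅x⁆ u∈B))) u↛w) , c∈C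
        where c∈X = x∉p⇒x∈∁p (x∉p∪⁅y⁆ (∈Cᵥ⇒∉ c∈C ∘ p⊆p∪⁅x⁆) (∈Cᵥ⇒≢v c∈C))

      injective : ∀ {x x′ c} → x ∈ X → x′ ∈ X → R x c → R x′ c → x ≡ x′
      injective {x} {x′} x∈X x′∈X Rxc Rx′c = decidable-stable (x ≟ x′) λ x≢x′ →
        ∣p∣≡0⇒x∉p (trans (∣C[S∪⁅q⁆]-v∣ (base x∈X) (x∉p∪⁅y⁆ x′∉B (≢-sym x≢x′)) x′≢v) k≡0)
                  (∈C[S∪⁅q⁆]-v⁺ Rxc (∈commonOut⁻ Rx′c (p⊆p∪⁅x⁆ x∈p∪⁅x⁆)))
        where
        x′∉B = proj₁ (x∉p∪⁅y⁆⁻ (x∈∁p⇒x∉p x′∈X))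
        x′≢v = proj₂ (x∉p∪⁅y⁆⁻ (x∈∁p⇒x∉p x′∈X))

      absurd : ⊥
      absurd = <⇒≱ (x∈p⇒∣p-x∣<∣p∣ w∈X) (injection⇒≤ R refl image injective)
        where w∈X = x∉p⇒x∈∁p (x∉p∪⁅y⁆ w∉B w≢v)

    ⟶-offApex-k>0 : 0 < k → ∀ {u w} → u ≢ v → w ≢ v → u ≢ w → u ⟶ w
    ⟶-offApex-k>0 0<k {u} {w} u≢v w≢v u≢w
      with subsetAvoiding {F = ⁅ v ⁆ ∪⁅ u ⁆ ∪⁅ w ⁆} (subst (λ j → j + r ≤ n D) (sym ∣F∣≡3) 3+r≤n)
      where
      ∣F∣≡3 : ∣ ⁅ v ⁆ ∪⁅ u ⁆ ∪⁅ w ⁆ ∣ ≡ 3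
      ∣F∣≡3 = trans (∣p∪⁅x⁆∣ (x∉p∪⁅y⁆ (x≢y⇒x∉⁅y⁆ w≢v) (≢-sym u≢w)))
                    (cong suc (trans (∣p∪⁅x⁆∣ (x≢y⇒x∉⁅y⁆ u≢v)) (cong suc (∣⁅x⁆∣≡1 v))))
      3+r≤n : 3 + r ≤ n D
      3+r≤n = liking⇒t<n (t≤n , liking)
    ... | A , A⊆∁F , ∣A∣≡r = ⟶-stable λ u↛w → AtLeastTwoCommonOut.absurd 0<k u≢v w≢v u≢w u↛w
      (p⊆∁q∧x∈q⇒x∉p A⊆∁F (p⊆p∪⁅x⁆ (p⊆p∪⁅x⁆ (x∈⁅x⁆ v))))
      (p⊆∁q∧x∈q⇒x∉p A⊆∁F (p⊆p∪⁅x⁆ x∈p∪⁅x⁆))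
      (p⊆∁q∧x∈q⇒x∉p A⊆∁F x∈p∪⁅x⁆) ∣A∣≡r

    ⟶-offApex-k≡0 : k ≡ 0 → 0 < r → ∀ {u w} → u ≢ v → w ≢ v → u ≢ w → u ⟶ w
    ⟶-offApex-k≡0 k≡0 0<r {u} {w} u≢v w≢v u≢w
      with subsetContainingAvoiding {F = ⁅ v ⁆ ∪⁅ w ⁆} (x∉p∪⁅y⁆ (x≢y⇒x∉⁅y⁆ u≢v) u≢w) 0<r
             (subst (λ j → j + r ≤ n D) (sym ∣F∣≡2) t≤n)
      where
      ∣F∣≡2 : ∣ ⁅ v ⁆ ∪⁅ w ⁆ ∣ ≡ 2
      ∣F∣≡2 = trans (∣p∪⁅x⁆∣ (x≢y⇒x∉⁅y⁆ w≢v)) (cong suc (∣⁅x⁆∣≡1 v))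
    ... | B , B⊆∁F , u∈B , ∣B∣≡r = ⟶-stable λ u↛w → OneCommonOut.absurd k≡0 w≢v u↛w
      (p⊆∁q∧x∈q⇒x∉p B⊆∁F (p⊆p∪⁅x⁆ (x∈⁅x⁆ v)))
      (p⊆∁q∧x∈q⇒x∉p B⊆∁F x∈p∪⁅x⁆) u∈B ∣B∣≡r

    ⟶-offApex : ¬ (r ≡ 0 × k ≡ 0) → ∀ {u w} → u ≢ v → w ≢ v → u ≢ w → u ⟶ w
    ⟶-offApex nondegenerate with k ℕ.≟ 0 | r ℕ.≟ 0
    ... | no k≢0  | _       = ⟶-offApex-k>0 (n≢0⇒n>0 k≢0)
    ... | yes k≡0 | no r≢0  = ⟶-offApex-k≡0 k≡0 (n≢0⇒n>0 r≢0)
    ... | yes k≡0 | yes r≡0 = contradiction (r≡0 , k≡0) nondegenerate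

    ⟶-all : ¬ (r ≡ 0 × k ≡ 0) → ∀ {u w} → u ≢ w → u ⟶ w
    ⟶-all nondegenerate {u} {w} u≢w with u ≟ v | w ≟ v
    ... | yes refl | _        = v⟶ (≢-sym u≢w)
    ... | no u≢v   | yes refl = ⟶v u≢v
    ... | no u≢v   | no w≢v   = ⟶-offApex nondegenerate u≢v w≢v u≢w

lemma3p5 : (t l : ℕ) → 2 ≤ t → 1 ≤ l → ¬ ((t ≡ 2) × (l ≡ 1)) →
    (D : Digraph) → IsLiking t l D →
    (v : Fin (n D)) → (∀ w → (w ∈ N⁺ D v → w ≢ v) × (w ≢ v → w ∈ N⁺ D v)) →
    D ≅ complete (t + l)
lemma3p5 (suc (suc r)) (suc k) _ _ ¬t≡2×l≡1 D liking@(t≤n , likes) v N⁺v≡V-v =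
  subst (λ m → D ≅ complete m) (liking⇒n≡t+l ⟶all liking) (≅complete ⟶all)
  where
  open Arcs D
  ⟶all : ∀ {u w} → u ≢ w → u ⟶ w
  ⟶all = Dominating.⟶-all t≤n likes v (λ w≢v → ∈N⁺⁻ (proj₂ (N⁺v≡V-v _) w≢v))
           (λ (r≡0 , k≡0) → ¬t≡2×l≡1 (cong (2 +_) r≡0 , cong suc k≡0))
lemma3p5 (suc zero) _ (s≤s ())
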